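{- For $n\ge 1$, the number of subsets $S\subseteq\{0,1,\dots,n-1\}$ with $|S+S|=|S-S|$ is at least $(2\times10^{ -5})\,2^n$.
   Context: $S+S=\{s_1+s_2: s_1,s_2\in S\}$ and $S-S=\{s_1-s_2: s_1,s_2\in S\}$. -}

module Defs where

open import Data.Nat using (ℕ; zero; suc; _+_; _*_; _≟_)
open import Data.Bool using (Bool; true; false)
open import Data.Fin using (Fin; toℕ)
open import Data.Fin.Subset using (Subset; _∈_; ∣_∣)
open import Data.Fin.Subset.Properties using (_∈?_)
open import Data.Vec using (Vec; []; _∷_; tabulate)
open import Data.List using (List; []; _∷_; _++_; map; filter; length)
open import Data.Product using (Σ; _×_; _,_)
open import Relation.Nullary using (Dec; yes; no; ¬_)
open import Relation.Nullary.Decidable using (⌊_⌋; _×-dec_)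
open import Relation.Binary.PropositionalEquality using (_≡_)
open import Data.Fin.Properties using (any?)

-- A subset S of {0,...,n-1} is a 'Subset n' (element i : Fin n stands for toℕ i).

InSumset : ∀ {n} → Subset n → ℕ → Set
InSumset {n} S k = Σ (Fin n) λ a → Σ (Fin n) λ b → (a ∈ S) × (b ∈ S) × (toℕ a + toℕ b ≡ k)

-- S - S, shifted by n so that it lies in {0,...,2n-1}:
-- k ∈ (S-S)+n iff ∃ a b ∈ S, a + n = b + k, i.e. a - b = k - n.
InDiffsetShifted : ∀ {n} → Subset n → ℕ → Set
InDiffsetShifted {n} S k = Σ (Fin n) λ a → Σ (Fin n) λ b → (a ∈ S) × (b ∈ S) × (toℕ a + n ≡ toℕ b + k)

inSumset? : ∀ {n} (S : Subset n) k → Dec (InSumset S k)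
inSumset? S k = any? λ a → any? λ b → (a ∈? S) ×-dec ((b ∈? S) ×-dec (toℕ a + toℕ b ≟ k))

inDiff? : ∀ {n} (S : Subset n) k → Dec (InDiffsetShifted S k)
inDiff? {n} S k = any? λ a → any? λ b → (a ∈? S) ×-dec ((b ∈? S) ×-dec (toℕ a + n ≟ toℕ b + k))

sumset : ∀ {n} → Subset n → Subset (n + n)
sumset S = tabulate λ k → ⌊ inSumset? S (toℕ k) ⌋

-- (S - S) + n as a subset of {0,...,2n-1} (translation preserves cardinality)
diffsetShifted : ∀ {n} → Subset n → Subset (n + n)
diffsetShifted S = tabulate λ k → ⌊ inDiff? S (toℕ k) ⌋

allSubsets : (n : ℕ) → List (Subset n)
allSubsets zero = [] ∷ []
allSubsets (suc n) = map (true ∷_) (allSubsets n) ++ map (false ∷_) (allSubsets n)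

countBalanced : ℕ → ℕ
countBalanced n = length (filter (λ S → ∣ sumset S ∣ ≟ ∣ diffsetShifted S ∣) (allSubsets n))

module Submission where

-- Let n = 15 + N and call S ⊆ [0, n) fringed if it contains {0, …, 4} and {n − 5, …, n − 1}; there are
-- 2^(n − 10) = 32 · 2^N fringed sets. For a fringed S the sumset lies in [0, 2n − 2] and the difference set
-- in [−(n − 1), n − 1], so |S + S| = |S − S| = 2n − 1 unless some sum or difference is missing.
-- If the sum 9 + j (0 ≤ j ≤ N) is missing, the five positions 5 + j, …, 9 + j avoid S (each would combine
-- with the left fringe), and of each of the ⌊j/2⌋ disjoint pairs {x, 9 + j − x} in [5, 5 + j) at most one
-- point lies in S. These are independent conditions on distinct positions, so at most
-- 2^N (3/4)^⌊j/2⌋ fringed sets miss 9 + j. The large sums and the differences are covered by similar events,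
-- and each of the three families of bounds sums to at most 8 · 2^N. Hence at least (32 − 24) · 2^N = 2^(n − 12)
-- sets are balanced, comfortably more than 2 · 10⁻⁵ · 2^n; for n < 15 the empty set suffices.

open import Data.Bool using (Bool; true; false; _∧_; _∨_; not; if_then_else_)
open import Data.Bool.Properties
  using (∧-assoc; ∧-conicalˡ; ∧-conicalʳ; ∨-conicalˡ; ∨-conicalʳ; not-injective)
open import Data.Empty using (⊥)
open import Data.Fin as Fin using (Fin; toℕ; fromℕ)
open import Data.Fin.Properties using (toℕ<n; toℕ-fromℕ; toℕ-injective)
open import Data.Fin.Subset using (Subset; _∈_; _∉_; ∁; ⁅_⁆; ∣_∣; Empty) renaming (⊥ to ∅)
open import Data.Fin.Subset.Properties
  using ( ⊆-antisym; x∉p⇒x∈∁p; x∈∁p⇒x∉p; x≢y⇒x∉⁅y⁆; x∉⁅y⁆⇒x≢y; ∣∁p∣≡n∸∣p∣; ∣⁅x⁆∣≡1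
        ; Empty-unique; ∣⊥∣≡0; ∉⊥)
open import Data.List using (List; []; _∷_; _++_; concatMap; map; filter; length)
open import Data.List.Properties using (filter-++; length-++)
open import Data.List.Relation.Binary.Disjoint.Propositional using (Disjoint)
open import Data.List.Relation.Unary.All as All using (All; []; _∷_)
import Data.List.Relation.Unary.All.Properties as All
open import Data.List.Relation.Unary.AllPairs using ([]; _∷_)
open import Data.List.Relation.Unary.Unique.Propositional using (Unique)
import Data.List.Relation.Unary.Unique.Propositional.Properties as Unique
open import Data.Nat
  using (ℕ; zero; suc; _+_; _*_; _^_; _∸_; _⊓_; ⌊_/2⌋; ⌈_/2⌉; _≤_; _<_; _≟_; z≤n; s≤s; z<s)
open import Data.Nat.Properties
open import Algebra.Properties.CommutativeSemigroup +-commutativeSemigroup using (interchange; x∙yz≈y∙xz)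
open import Data.Nat.Tactic.RingSolver using (solve-∀)
open import Data.Product using (Σ-syntax; _×_; _,_; proj₁; proj₂)
open import Data.Sum as Sum using (_⊎_; inj₁; inj₂)
open import Data.Vec using (Vec; []; _∷_; tabulate; here; there)
open import Data.Vec.Properties using (lookup∘tabulate; lookup⇒[]=; []=⇒lookup)
open import Function using (_∘_)
open import Level using (0ℓ)
open import Relation.Binary.PropositionalEquality
open import Relation.Nullary using (Dec; ¬_; does; contradiction)
open import Relation.Nullary.Decidable using (⌊_⌋; isYes≗does; dec-true; dec-false)
open import Relation.Unary using (Pred; Decidable)

open import Defs

-- Counting bit vectors

bit : ∀ {n} → Vec Bool n → ℕ → Bool
bit []      _       = false
bit (b ∷ _) zero    = b
bit (_ ∷ v) (suc i) = bit v i

Ignores : ∀ {n} → ℕ → (Vec Bool n → Bool) → Set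
Ignores i Q = ∀ u v → (∀ j → j ≢ i → bit u j ≡ bit v j) → Q u ≡ Q v

_≐_ : Bool → Bool → Bool
x ≐ true  = x
x ≐ false = not x

*2≡+ : ∀ {x y} → x ≡ y → x * 2 ≡ x + y
*2≡+ {x} refl = trans (*-comm x 2) (cong (x +_) (+-identityʳ x))

-- Opaque: unfolding count (15 + N) P during unification would produce 2^15 summands.
opaque
  count : ∀ n → (Vec Bool n → Bool) → ℕ
  count zero    P = if P [] then 1 else 0
  count (suc n) P = count n (P ∘ (true ∷_)) + count n (P ∘ (false ∷_))

  count-cong : ∀ n {P Q : Vec Bool n → Bool} → (∀ v → P v ≡ Q v) → count n P ≡ count n Q
  count-cong zero    P≗Q rewrite P≗Q [] = refl
  count-cong (suc n) P≗Q = cong₂ _+_ (count-cong n (P≗Q ∘ (true ∷_))) (count-cong n (P≗Q ∘ (false ∷_)))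

  count-mono : ∀ n {P Q : Vec Bool n → Bool} → (∀ v → P v ≡ true → Q v ≡ true) → count n P ≤ count n Q
  count-mono zero {P} {Q} P⇒Q with P [] in eq
  ... | true  rewrite P⇒Q [] eq = ≤-refl
  ... | false = z≤n
  count-mono (suc n) P⇒Q = +-mono-≤ (count-mono n (P⇒Q ∘ (true ∷_))) (count-mono n (P⇒Q ∘ (false ∷_)))

  count-false : ∀ n → count n (λ _ → false) ≡ 0
  count-false zero    = refl
  count-false (suc n) rewrite count-false n = refl

  count-true : ∀ n → count n (λ _ → true) ≡ 2 ^ n
  count-true zero    = refl
  count-true (suc n) rewrite count-true n | +-identityʳ (2 ^ n) = refl

  count-pos : ∀ n (P : Vec Bool n → Bool) v → P v ≡ true → 1 ≤ count n P
  count-pos zero    P []          Pv rewrite Pv = ≤-refl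
  count-pos (suc n) P (true ∷ v)  Pv = ≤-trans (count-pos n _ v Pv) (m≤m+n _ _)
  count-pos (suc n) P (false ∷ v) Pv = ≤-trans (count-pos n _ v Pv) (m≤n+m _ _)

  count-split : ∀ n (Q P : Vec Bool n → Bool) →
                count n P ≡ count n (λ v → Q v ∧ P v) + count n (λ v → not (Q v) ∧ P v)
  count-split zero Q P with Q []
  ... | true  = sym (+-identityʳ _)
  ... | false = refl
  count-split (suc n) Q P =
    trans (cong₂ _+_ (count-split n (Q ∘ (true ∷_)) (P ∘ (true ∷_)))
                     (count-split n (Q ∘ (false ∷_)) (P ∘ (false ∷_))))
          (interchange (count n _) (count n _) (count n _) (count n _))

  count-∨ : ∀ n (P Q : Vec Bool n → Bool) → count n (λ v → P v ∨ Q v) ≤ count n P + count n Q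
  count-∨ zero P Q with P [] | Q []
  ... | true  | true  = s≤s z≤n
  ... | true  | false = ≤-refl
  ... | false | _     = ≤-refl
  count-∨ (suc n) P Q =
    ≤-trans (+-mono-≤ (count-∨ n (P ∘ (true ∷_)) (Q ∘ (true ∷_))) (count-∨ n (P ∘ (false ∷_)) (Q ∘ (false ∷_))))
            (≤-reflexive (interchange (count n _) (count n _) (count n _) (count n _)))

  head-ignored : ∀ n (Q : Vec Bool (suc n) → Bool) → Ignores 0 Q →
                 count n (Q ∘ (true ∷_)) ≡ count n (Q ∘ (false ∷_))
  head-ignored n Q ign =
    count-cong n (λ v → ign (true ∷ v) (false ∷ v) λ { zero 0≢0 → contradiction refl 0≢0 ; (suc j) _ → refl })

  count-fix : ∀ n i b (Q : Vec Bool n → Bool) → i < n → Ignores i Q →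
              count n (λ v → (bit v i ≐ b) ∧ Q v) * 2 ≡ count n Q
  count-fix (suc n) zero true  Q _ ign rewrite count-false n | +-identityʳ (count n (Q ∘ (true ∷_))) =
    *2≡+ (head-ignored n Q ign)
  count-fix (suc n) zero false Q _ ign rewrite count-false n =
    trans (*2≡+ (sym (head-ignored n Q ign))) (+-comm (count n (Q ∘ (false ∷_))) _)
  count-fix (suc n) (suc i) b Q (s≤s i<n) ign =
    trans (*-distribʳ-+ 2 (count n _) (count n _))
          (cong₂ _+_ (count-fix n i b (Q ∘ (true ∷_)) i<n (λ u v u≈v → ign _ _ (shift true u v u≈v)))
                     (count-fix n i b (Q ∘ (false ∷_)) i<n (λ u v u≈v → ign _ _ (shift false u v u≈v))))
    where
    shift : ∀ x (u v : Vec Bool n) → (∀ j → j ≢ i → bit u j ≡ bit v j) →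
            ∀ j → j ≢ suc i → bit (x ∷ u) j ≡ bit (x ∷ v) j
    shift x u v u≈v zero    _      = refl
    shift x u v u≈v (suc j) j≢1+i = u≈v j (j≢1+i ∘ cong suc)

any≤ : ∀ {n} → ℕ → (ℕ → Vec Bool n → Bool) → Vec Bool n → Bool
any≤ zero    E v = E 0 v
any≤ (suc N) E v = E 0 v ∨ any≤ N (E ∘ suc) v

any≤-false : ∀ {n} N (E : ℕ → Vec Bool n → Bool) v k → k ≤ N → any≤ N E v ≡ false → E k v ≡ false
any≤-false zero    E v zero    _         none = none
any≤-false (suc N) E v zero    _         none = ∨-conicalˡ (E 0 v) _ none
any≤-false (suc N) E v (suc k) (s≤s k≤N) none = any≤-false N (E ∘ suc) v k k≤N (∨-conicalʳ (E 0 v) _ none)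

-- Finite sums and geometric bounds

sum≤ : ℕ → (ℕ → ℕ) → ℕ
sum≤ zero    c = c 0
sum≤ (suc N) c = c 0 + sum≤ N (c ∘ suc)

sum≤-*ˡ : ∀ N a c → sum≤ N (λ k → a * c k) ≡ a * sum≤ N c
sum≤-*ˡ zero    a c = refl
sum≤-*ˡ (suc N) a c = trans (cong (a * c 0 +_) (sum≤-*ˡ N a (c ∘ suc))) (sym (*-distribˡ-+ a (c 0) _))

sum≤-last : ∀ N c → sum≤ (suc N) c ≡ sum≤ N c + c (suc N)
sum≤-last zero    c = refl
sum≤-last (suc N) c = trans (cong (c 0 +_) (sum≤-last N (c ∘ suc))) (sym (+-assoc (c 0) _ _))

sum≤-reverse : ∀ N c → sum≤ N (c ∘ (N ∸_)) ≡ sum≤ N c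
sum≤-reverse zero    c = refl
sum≤-reverse (suc N) c = begin
  c (suc N) + sum≤ N (c ∘ (N ∸_)) ≡⟨ cong (c (suc N) +_) (sum≤-reverse N c) ⟩
  c (suc N) + sum≤ N c            ≡⟨ +-comm (c (suc N)) _ ⟩
  sum≤ N c + c (suc N)            ≡⟨ sum≤-last N c ⟨
  sum≤ (suc N) c                  ∎
  where open ≡-Reasoning

count-any≤ : ∀ n N (E : ℕ → Vec Bool n → Bool) → count n (any≤ N E) ≤ sum≤ N (λ k → count n (E k))
count-any≤ n zero    E = ≤-refl
count-any≤ n (suc N) E =
  ≤-trans (count-∨ n (E 0) (any≤ N (E ∘ suc))) (+-monoʳ-≤ (count n (E 0)) (count-any≤ n N (E ∘ suc)))

-- Both bounds are proved for all A at once: the two terms of exponent 0 are at most A each, and the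
-- remaining terms, multiplied by 4, satisfy the hypothesis for 3 A, so they add up to at most 6 A.
private
  level-zero : ∀ x A → x * 4 ^ 0 ≤ A * 3 ^ 0 → x ≤ A
  level-zero x A = subst₂ _≤_ (*-identityʳ x) (*-identityʳ A)

  level-down : ∀ x A τ → x * 4 ^ suc τ ≤ A * 3 ^ suc τ → 4 * x * 4 ^ τ ≤ 3 * A * 3 ^ τ
  level-down x A τ = subst₂ _≤_ (reassoc x 4 (4 ^ τ)) (reassoc A 3 (3 ^ τ))
    where
    reassoc : ∀ a b c → a * (b * c) ≡ b * a * c
    reassoc = solve-∀

  assemble : ∀ {x y} S A → x ≤ A → y ≤ A → 4 * S ≤ 8 * (3 * A) → x + y + S ≤ 8 * A
  assemble S A x≤A y≤A 4S≤24A = ≤-trans (+-mono-≤ (+-mono-≤ x≤A y≤A) S≤6A) (≤-reflexive (eight A))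
    where
    twentyfour : ∀ a → 8 * (3 * a) ≡ 4 * (6 * a)
    twentyfour = solve-∀
    eight : ∀ a → a + a + 6 * a ≡ 8 * a
    eight = solve-∀
    S≤6A : S ≤ 6 * A
    S≤6A = *-cancelˡ-≤ 4 (≤-trans 4S≤24A (≤-reflexive (twentyfour A)))

  assemble-two : ∀ {x y} A → x ≤ A → y ≤ A → x + y ≤ 8 * A
  assemble-two A x≤A y≤A = subst (_≤ 8 * A) (+-identityʳ _) (assemble 0 A x≤A y≤A z≤n)

sum≤-geometric-⌊/2⌋ : ∀ N A (c : ℕ → ℕ) → (∀ k → k ≤ N → c k * 4 ^ ⌊ k /2⌋ ≤ A * 3 ^ ⌊ k /2⌋) →
                      sum≤ N c ≤ 8 * A
sum≤-geometric-⌊/2⌋ zero A c bound = ≤-trans (level-zero (c 0) A (bound 0 z≤n)) (m≤n*m A 8)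
sum≤-geometric-⌊/2⌋ (suc zero) A c bound =
  assemble-two A (level-zero (c 0) A (bound 0 z≤n)) (level-zero (c 1) A (bound 1 ≤-refl))
sum≤-geometric-⌊/2⌋ (suc (suc N)) A c bound =
  ≤-trans (≤-reflexive (sym (+-assoc (c 0) (c 1) _)))
    (assemble (sum≤ N (c ∘ suc ∘ suc)) A (level-zero (c 0) A (bound 0 z≤n)) (level-zero (c 1) A (bound 1 (s≤s z≤n)))
      (≤-trans (≤-reflexive (sym (sum≤-*ˡ N 4 (c ∘ suc ∘ suc))))
        (sum≤-geometric-⌊/2⌋ N (3 * A) (λ k → 4 * c (2 + k))
          (λ k k≤N → level-down (c (2 + k)) A ⌊ k /2⌋ (bound (2 + k) (s≤s (s≤s k≤N)))))))

sum≤-geometric-⊓ : ∀ N A (c : ℕ → ℕ) → (∀ m → m ≤ N → c m * 4 ^ (m ⊓ (N ∸ m)) ≤ A * 3 ^ (m ⊓ (N ∸ m))) →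
                   sum≤ N c ≤ 8 * A
sum≤-geometric-⊓ zero A c bound = ≤-trans (level-zero (c 0) A (bound 0 z≤n)) (m≤n*m A 8)
sum≤-geometric-⊓ (suc zero) A c bound =
  assemble-two A (level-zero (c 0) A (bound 0 z≤n)) (level-zero (c 1) A (bound 1 ≤-refl))
sum≤-geometric-⊓ (suc (suc N)) A c bound = begin
  c 0 + sum≤ (suc N) (c ∘ suc)  ≡⟨ cong (c 0 +_) (sum≤-last N (c ∘ suc)) ⟩
  c 0 + (S + c (2 + N))         ≡⟨ swap (c 0) S (c (2 + N)) ⟩
  c 0 + c (2 + N) + S           ≤⟨ assemble S A (level-zero (c 0) A (bound 0 z≤n)) last≤A
                                     (≤-trans (≤-reflexive (sym (sum≤-*ˡ N 4 (c ∘ suc))))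
                                              (sum≤-geometric-⊓ N (3 * A) (λ m → 4 * c (suc m)) inner)) ⟩
  8 * A                         ∎
  where
  open ≤-Reasoning
  S : ℕ
  S = sum≤ N (c ∘ suc)
  swap : ∀ x y z → x + (y + z) ≡ x + z + y
  swap = solve-∀
  last≤A : c (2 + N) ≤ A
  last≤A = level-zero (c (2 + N)) A
    (subst (λ τ → c (2 + N) * 4 ^ ((2 + N) ⊓ τ) ≤ A * 3 ^ ((2 + N) ⊓ τ)) (n∸n≡0 N) (bound (2 + N) ≤-refl))
  inner : ∀ m → m ≤ N → 4 * c (suc m) * 4 ^ (m ⊓ (N ∸ m)) ≤ 3 * A * 3 ^ (m ⊓ (N ∸ m))
  inner m m≤N = level-down (c (suc m)) A (m ⊓ (N ∸ m))
    (subst (λ τ → c (suc m) * 4 ^ (suc m ⊓ τ) ≤ A * 3 ^ (suc m ⊓ τ)) (+-∸-assoc 1 m≤N)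
           (bound (suc m) (s≤s (m≤n⇒m≤1+n m≤N))))

-- Systems of constraints on distinct positions

data Constraint : Set where
  _≔_   : ℕ → Bool → Constraint
  ¬both : ℕ → ℕ → Constraint

sat : ∀ {n} → Constraint → Vec Bool n → Bool
sat (i ≔ b)     v = bit v i ≐ b
sat (¬both i j) v = not (bit v i ∧ bit v j)

holds : ∀ {n} → List Constraint → Vec Bool n → Bool
holds []       v = true
holds (c ∷ cs) v = sat c v ∧ holds cs v

∧-false : ∀ x y → x ∧ y ≡ false → x ≡ false ⊎ y ≡ false
∧-false false y _  = inj₁ refl
∧-false true  y eq = inj₂ eq

holds-++ : ∀ {n} xs ys (v : Vec Bool n) → holds (xs ++ ys) v ≡ holds xs v ∧ holds ys v
holds-++ []       ys v = refl
holds-++ (c ∷ xs) ys v = trans (cong (sat c v ∧_) (holds-++ xs ys v)) (sym (∧-assoc (sat c v) _ _))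

support : Constraint → List ℕ
support (i ≔ _)     = i ∷ []
support (¬both i j) = i ∷ j ∷ []

positions : List Constraint → List ℕ
positions = concatMap support

#fixed #excluded : List Constraint → ℕ
#fixed []               = 0
#fixed (_ ≔ _ ∷ cs)     = suc (#fixed cs)
#fixed (¬both _ _ ∷ cs) = #fixed cs
#excluded []               = 0
#excluded (_ ≔ _ ∷ cs)     = #excluded cs
#excluded (¬both _ _ ∷ cs) = suc (#excluded cs)

WellFormed : ℕ → List Constraint → Set
WellFormed n cs = All (_< n) (positions cs) × Unique (positions cs)

holds-ignores : ∀ {n} i cs → All (i ≢_) (positions cs) → Ignores {n} i (holds cs)
holds-ignores i []               _                 u v u≈v = refl
holds-ignores i (j ≔ b ∷ cs)     (i≢j ∷ i∉)        u v u≈v =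
  cong₂ (λ x y → (x ≐ b) ∧ y) (u≈v j (≢-sym i≢j)) (holds-ignores i cs i∉ u v u≈v)
holds-ignores i (¬both j k ∷ cs) (i≢j ∷ i≢k ∷ i∉) u v u≈v =
  cong₂ (λ x y → not x ∧ y) (cong₂ _∧_ (u≈v j (≢-sym i≢j)) (u≈v k (≢-sym i≢k))) (holds-ignores i cs i∉ u v u≈v)

count-¬both : ∀ n i j (Q : Vec Bool n → Bool) → i < n → j < n → i ≢ j → Ignores i Q → Ignores j Q →
              count n (λ v → not (bit v i ∧ bit v j) ∧ Q v) * 4 ≡ count n Q * 3
count-¬both n i j Q i<n j<n i≢j ign-i ign-j = +-cancelˡ-≡ C _ _ (begin
  C + X * 4      ≡⟨ cong (_+ X * 4) (sym both*4) ⟩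
  Y * 4 + X * 4  ≡⟨ *-distribʳ-+ 4 Y X ⟨
  (Y + X) * 4    ≡⟨ cong (_* 4) (count-split n (λ v → bit v i ∧ bit v j) Q) ⟨
  C * 4          ≡⟨ *-suc C 3 ⟩
  C + C * 3      ∎)
  where
  open ≡-Reasoning
  C X Y Y′ : ℕ
  C = count n Q
  X = count n (λ v → not (bit v i ∧ bit v j) ∧ Q v)
  Y = count n (λ v → (bit v i ∧ bit v j) ∧ Q v)
  Y′ = count n (λ v → bit v i ∧ (bit v j ∧ Q v))
  j-and-Q-ignores-i : Ignores i (λ v → bit v j ∧ Q v)
  j-and-Q-ignores-i u v u≈v = cong₂ _∧_ (u≈v j (≢-sym i≢j)) (ign-i u v u≈v)
  both*4 : Y * 4 ≡ C
  both*4 = begin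
    Y * 4                              ≡⟨ cong (_* 4) (count-cong n (λ v → ∧-assoc (bit v i) (bit v j) (Q v))) ⟩
    Y′ * 4                             ≡⟨ *-assoc Y′ 2 2 ⟨
    Y′ * 2 * 2                         ≡⟨ cong (_* 2) (count-fix n i true _ i<n j-and-Q-ignores-i) ⟩
    count n (λ v → bit v j ∧ Q v) * 2  ≡⟨ count-fix n j true Q j<n ign-j ⟩
    C                                  ∎

count-holds : ∀ n cs → WellFormed n cs →
              count n (holds cs) * 2 ^ #fixed cs * 4 ^ #excluded cs ≡ 2 ^ n * 3 ^ #excluded cs
count-holds n [] _ =
  trans (*-identityʳ _) (trans (*-identityʳ _) (trans (count-true n) (sym (*-identityʳ _))))
count-holds n (i ≔ b ∷ cs) (i<n ∷ <n , i∉ ∷ unique) = begin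
  X * (2 * 2 ^ f) * 4 ^ p  ≡⟨ cong (_* 4 ^ p) (*-assoc X 2 (2 ^ f)) ⟨
  X * 2 * 2 ^ f * 4 ^ p    ≡⟨ cong (λ z → z * 2 ^ f * 4 ^ p) (count-fix n i b (holds cs) i<n (holds-ignores i cs i∉)) ⟩
  C * 2 ^ f * 4 ^ p        ≡⟨ count-holds n cs (<n , unique) ⟩
  2 ^ n * 3 ^ p            ∎
  where
  open ≡-Reasoning
  X C f p : ℕ
  X = count n (holds (i ≔ b ∷ cs))
  C = count n (holds cs)
  f = #fixed cs
  p = #excluded cs
count-holds n (¬both i j ∷ cs) (i<n ∷ j<n ∷ <n , (i≢j ∷ i∉) ∷ j∉ ∷ unique) = begin
  X * 2 ^ f * (4 * 4 ^ p)  ≡⟨ pull-4 X (2 ^ f) (4 ^ p) ⟩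
  X * 4 * (2 ^ f * 4 ^ p)  ≡⟨ cong (_* (2 ^ f * 4 ^ p)) (count-¬both n i j (holds cs) i<n j<n i≢j
                                (holds-ignores i cs i∉) (holds-ignores j cs j∉)) ⟩
  C * 3 * (2 ^ f * 4 ^ p)  ≡⟨ push-3 C (2 ^ f) (4 ^ p) ⟩
  C * 2 ^ f * 4 ^ p * 3    ≡⟨ cong (_* 3) (count-holds n cs (<n , unique)) ⟩
  2 ^ n * 3 ^ p * 3        ≡⟨ *-assoc (2 ^ n) (3 ^ p) 3 ⟩
  2 ^ n * (3 ^ p * 3)      ≡⟨ cong (2 ^ n *_) (*-comm (3 ^ p) 3) ⟩
  2 ^ n * (3 * 3 ^ p)      ∎
  where
  open ≡-Reasoning
  X C f p : ℕ
  X = count n (holds (¬both i j ∷ cs))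
  C = count n (holds cs)
  f = #fixed cs
  p = #excluded cs
  pull-4 : ∀ x a b → x * a * (4 * b) ≡ x * 4 * (a * b)
  pull-4 = solve-∀
  push-3 : ∀ x a b → x * 3 * (a * b) ≡ x * a * b * 3
  push-3 = solve-∀

_∈[_,_⟩ : ℕ → ℕ → ℕ → Set
p ∈[ a , b ⟩ = a ≤ p × p < b

∈[]-mono : ∀ {p a b c d} → c ≤ a → b ≤ d → p ∈[ a , b ⟩ → p ∈[ c , d ⟩
∈[]-mono c≤a b≤d (a≤p , p<b) = ≤-trans c≤a a≤p , <-≤-trans p<b b≤d

∈[]-widen : ∀ {p a l} → p ∈[ suc a , suc a + l ⟩ → p ∈[ a , a + suc l ⟩
∈[]-widen {a = a} {l} = ∈[]-mono (n≤1+n a) (≤-reflexive (sym (+-suc a l)))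

∈[]-extend : ∀ {p b t} → p ∈[ b , b + t ⟩ → p ∈[ b , b + suc t ⟩
∈[]-extend {b = b} {t} = ∈[]-mono ≤-refl (+-monoʳ-≤ b (n≤1+n t))

∈[]-separated : ∀ {p a b c d} → b ≤ c → p ∈[ a , b ⟩ → p ∈[ c , d ⟩ → ⊥
∈[]-separated b≤c (_ , p<b) (c≤p , _) = <⇒≱ p<b (≤-trans b≤c c≤p)

separated : ∀ {R S : ℕ → Set} {xs ys} → All R xs → All S ys → (∀ {p} → R p → S p → ⊥) → Disjoint xs ys
separated Rxs Sys R∩S=∅ (p∈xs , p∈ys) = R∩S=∅ (All.lookup Rxs p∈xs) (All.lookup Sys p∈ys)

fill : ℕ → ℕ → Bool → List Constraint
fill a zero    b = []
fill a (suc l) b = a ≔ b ∷ fill (suc a) l b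

-- ¬both (a + k) (b + t − 1 − k) for k < t: every pair has the sum a + b + t − 1.
sumPairs : ℕ → ℕ → ℕ → List Constraint
sumPairs a b zero    = []
sumPairs a b (suc t) = ¬both a (b + t) ∷ sumPairs (suc a) b t

diffPairs : ℕ → ℕ → ℕ → List Constraint
diffPairs a b zero    = []
diffPairs a b (suc t) = ¬both a b ∷ diffPairs (suc a) (suc b) t

fill-positions : ∀ a l b → All (_∈[ a , a + l ⟩) (positions (fill a l b))
fill-positions a zero    b = []
fill-positions a (suc l) b = (≤-refl , m<m+n a z<s) ∷ All.map ∈[]-widen (fill-positions (suc a) l b)

fill-unique : ∀ a l b → Unique (positions (fill a l b))
fill-unique a zero    b = []
fill-unique a (suc l) b = All.map (<⇒≢ ∘ proj₁) (fill-positions (suc a) l b) ∷ fill-unique (suc a) l b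

InBlocks : ℕ → ℕ → ℕ → ℕ → Set
InBlocks a b t p = p ∈[ a , a + t ⟩ ⊎ p ∈[ b , b + t ⟩

sumPairs-positions : ∀ a b t → All (InBlocks a b t) (positions (sumPairs a b t))
sumPairs-positions a b zero    = []
sumPairs-positions a b (suc t) =
  inj₁ (≤-refl , m<m+n a z<s) ∷ inj₂ (m≤m+n b t , +-monoʳ-< b ≤-refl) ∷
  All.map (Sum.map ∈[]-widen ∈[]-extend) (sumPairs-positions (suc a) b t)

diffPairs-positions : ∀ a b t → All (InBlocks a b t) (positions (diffPairs a b t))
diffPairs-positions a b zero    = []
diffPairs-positions a b (suc t) =
  inj₁ (≤-refl , m<m+n a z<s) ∷ inj₂ (≤-refl , m<m+n b z<s) ∷
  All.map (Sum.map ∈[]-widen ∈[]-widen) (diffPairs-positions (suc a) (suc b) t)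

sumPairs-unique : ∀ a b t → a + t ≤ b → Unique (positions (sumPairs a b t))
sumPairs-unique a b zero    _ = []
sumPairs-unique a b (suc t) a+t≤b =
  (<⇒≢ (<-≤-trans a<b (m≤m+n b t)) ∷ All.map a≢ rest) ∷ All.map b+t≢ rest ∷
  sumPairs-unique (suc a) b t 1+a+t≤b
  where
  1+a+t≤b : suc a + t ≤ b
  1+a+t≤b = ≤-trans (≤-reflexive (sym (+-suc a t))) a+t≤b
  a<b : a < b
  a<b = <-≤-trans (s≤s (m≤m+n a t)) 1+a+t≤b
  rest : All (InBlocks (suc a) b t) (positions (sumPairs (suc a) b t))
  rest = sumPairs-positions (suc a) b t
  a≢ : ∀ {p} → InBlocks (suc a) b t p → a ≢ p
  a≢ (inj₁ (a<p , _)) = <⇒≢ a<p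
  a≢ (inj₂ (b≤p , _)) = <⇒≢ (<-≤-trans a<b b≤p)
  b+t≢ : ∀ {p} → InBlocks (suc a) b t p → b + t ≢ p
  b+t≢ (inj₁ (_ , p<)) = >⇒≢ (<-≤-trans p< (≤-trans 1+a+t≤b (m≤m+n b t)))
  b+t≢ (inj₂ (_ , p<)) = >⇒≢ p<

diffPairs-unique : ∀ a b t → a + t ≤ b → Unique (positions (diffPairs a b t))
diffPairs-unique a b zero    _ = []
diffPairs-unique a b (suc t) a+t≤b =
  (<⇒≢ a<b ∷ All.map a≢ rest) ∷ All.map b≢ rest ∷
  diffPairs-unique (suc a) (suc b) t (m≤n⇒m≤1+n 1+a+t≤b)
  where
  1+a+t≤b : suc a + t ≤ b
  1+a+t≤b = ≤-trans (≤-reflexive (sym (+-suc a t))) a+t≤b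
  a<b : a < b
  a<b = <-≤-trans (s≤s (m≤m+n a t)) 1+a+t≤b
  rest : All (InBlocks (suc a) (suc b) t) (positions (diffPairs (suc a) (suc b) t))
  rest = diffPairs-positions (suc a) (suc b) t
  a≢ : ∀ {p} → InBlocks (suc a) (suc b) t p → a ≢ p
  a≢ (inj₁ (a<p , _)) = <⇒≢ a<p
  a≢ (inj₂ (b<p , _)) = <⇒≢ (<-trans a<b b<p)
  b≢ : ∀ {p} → InBlocks (suc a) (suc b) t p → b ≢ p
  b≢ (inj₁ (_ , p<))  = >⇒≢ (<-≤-trans p< 1+a+t≤b)
  b≢ (inj₂ (b<p , _)) = <⇒≢ b<p

sumPairs-#fixed : ∀ a b t → #fixed (sumPairs a b t) ≡ 0
sumPairs-#fixed a b zero    = refl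
sumPairs-#fixed a b (suc t) = sumPairs-#fixed (suc a) b t

sumPairs-#excluded : ∀ a b t → #excluded (sumPairs a b t) ≡ t
sumPairs-#excluded a b zero    = refl
sumPairs-#excluded a b (suc t) = cong suc (sumPairs-#excluded (suc a) b t)

diffPairs-#fixed : ∀ a b t → #fixed (diffPairs a b t) ≡ 0
diffPairs-#fixed a b zero    = refl
diffPairs-#fixed a b (suc t) = diffPairs-#fixed (suc a) (suc b) t

diffPairs-#excluded : ∀ a b t → #excluded (diffPairs a b t) ≡ t
diffPairs-#excluded a b zero    = refl
diffPairs-#excluded a b (suc t) = cong suc (diffPairs-#excluded (suc a) (suc b) t)

nestedPairs : ℕ → ℕ → List Constraint
nestedPairs a j = sumPairs a (a + ⌈ j /2⌉) ⌊ j /2⌋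

nestedPairs-end : ∀ a j → a + ⌈ j /2⌉ + ⌊ j /2⌋ ≡ a + j
nestedPairs-end a j = trans (+-assoc a _ _) (cong (a +_) (trans (+-comm ⌈ j /2⌉ _) (⌊n/2⌋+⌈n/2⌉≡n j)))

nestedPairs-positions : ∀ a j → All (_∈[ a , a + j ⟩) (positions (nestedPairs a j))
nestedPairs-positions a j =
  All.map (λ { (inj₁ p∈) → ∈[]-mono ≤-refl (+-monoʳ-≤ a (⌊n/2⌋≤n j)) p∈
             ; (inj₂ p∈) → ∈[]-mono (m≤m+n a _) (≤-reflexive (nestedPairs-end a j)) p∈ })
          (sumPairs-positions a (a + ⌈ j /2⌉) ⌊ j /2⌋)

nestedPairs-unique : ∀ a j → Unique (positions (nestedPairs a j))
nestedPairs-unique a j = sumPairs-unique a (a + ⌈ j /2⌉) ⌊ j /2⌋ (+-monoʳ-≤ a (⌊n/2⌋≤⌈n/2⌉ j))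

fringe : ℕ → List Constraint
fringe N = fill 0 5 true ++ fill (10 + N) 5 true

event : ℕ → ℕ → List Constraint → List Constraint
event N w P = fringe N ++ fill w 5 false ++ P

FringeRegion : ℕ → ℕ → Set
FringeRegion N p = p ∈[ 0 , 5 ⟩ ⊎ p ∈[ 10 + N , 15 + N ⟩

Interior : ℕ → ℕ → ℕ → Set
Interior N w p = p ∈[ 5 , w ⟩ ⊎ p ∈[ 5 + w , 10 + N ⟩

fringe-positions : ∀ N → All (FringeRegion N) (positions (fringe N))
fringe-positions N =
  All.++⁺ (All.map inj₁ (fill-positions 0 5 true))
          (All.map (inj₂ ∘ ∈[]-mono ≤-refl (≤-reflexive (+-comm (10 + N) 5))) (fill-positions (10 + N) 5 true))

fringe-unique : ∀ N → Unique (positions (fringe N))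
fringe-unique N = Unique.++⁺ (fill-unique 0 5 true) (fill-unique (10 + N) 5 true)
  (separated (fill-positions 0 5 true) (fill-positions (10 + N) 5 true) (∈[]-separated (m≤m+n 5 (5 + N))))

FringeRegion⇒< : ∀ {N p} → FringeRegion N p → p < 15 + N
FringeRegion⇒< {N} (inj₁ (_ , p<5)) = <-≤-trans p<5 (m≤m+n 5 (10 + N))
FringeRegion⇒< (inj₂ (_ , p<))      = p<

fringe-wellFormed : ∀ N → WellFormed (15 + N) (fringe N)
fringe-wellFormed N = All.map FringeRegion⇒< (fringe-positions N) , fringe-unique N

event-wellFormed : ∀ N w P → 5 ≤ w → 5 + w ≤ 10 + N → All (Interior N w) (positions P) → Unique (positions P) →
                   WellFormed (15 + N) (event N w P)
event-wellFormed N w P 5≤w window≤ P-inside P-unique =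
  All.++⁺ (All.map FringeRegion⇒< (fringe-positions N)) (All.map (λ (_ , p<) → <-≤-trans p< (m≤n+m _ 5)) inside) ,
  Unique.++⁺ (fringe-unique N)
             (Unique.++⁺ (fill-unique w 5 false) P-unique (separated (fill-positions w 5 false) P-inside window∩P=∅))
             (separated (fringe-positions N) inside fringe∩inside=∅)
  where
  w+5≤ : w + 5 ≤ 10 + N
  w+5≤ = ≤-trans (≤-reflexive (+-comm w 5)) window≤
  window∩P=∅ : ∀ {p} → p ∈[ w , w + 5 ⟩ → Interior N w p → ⊥
  window∩P=∅ (w≤p , _) (inj₁ (_ , p<w))    = <⇒≱ p<w w≤p
  window∩P=∅ (_ , p<)  (inj₂ (5+w≤p , _)) = <⇒≱ p< (≤-trans (≤-reflexive (+-comm w 5)) 5+w≤p)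
  inside : All (_∈[ 5 , 10 + N ⟩) (positions (fill w 5 false ++ P))
  inside = All.++⁺ (All.map (∈[]-mono 5≤w w+5≤) (fill-positions w 5 false))
                   (All.map (λ { (inj₁ p∈) → ∈[]-mono ≤-refl (≤-trans (m≤m+n w 5) w+5≤) p∈
                               ; (inj₂ p∈) → ∈[]-mono (m≤m+n 5 w) ≤-refl p∈ })
                            P-inside)
  fringe∩inside=∅ : ∀ {p} → FringeRegion N p → p ∈[ 5 , 10 + N ⟩ → ⊥
  fringe∩inside=∅ (inj₁ p∈) p∈′ = ∈[]-separated ≤-refl p∈ p∈′
  fringe∩inside=∅ (inj₂ p∈) p∈′ = ∈[]-separated ≤-refl p∈′ p∈

count-event : ∀ N w P t → WellFormed (15 + N) (event N w P) → #fixed P ≡ 0 → #excluded P ≡ t →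
              count (15 + N) (holds (event N w P)) * 4 ^ t ≡ 2 ^ N * 3 ^ t
count-event N w P _ wf noFixed refl = *-cancelˡ-≡ _ _ (2 ^ 15) (begin
  2 ^ 15 * (c * 4 ^ t)             ≡⟨ *-assoc (2 ^ 15) c (4 ^ t) ⟨
  2 ^ 15 * c * 4 ^ t               ≡⟨ cong (_* 4 ^ t) (*-comm (2 ^ 15) c) ⟩
  c * 2 ^ 15 * 4 ^ t               ≡⟨ cong (λ f → c * 2 ^ (15 + f) * 4 ^ t) noFixed ⟨
  c * 2 ^ (15 + #fixed P) * 4 ^ t  ≡⟨ count-holds (15 + N) (event N w P) wf ⟩
  2 ^ (15 + N) * 3 ^ t             ≡⟨ cong (_* 3 ^ t) (^-distribˡ-+-* 2 15 N) ⟩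
  2 ^ 15 * 2 ^ N * 3 ^ t           ≡⟨ *-assoc (2 ^ 15) (2 ^ N) (3 ^ t) ⟩
  2 ^ 15 * (2 ^ N * 3 ^ t)         ∎)
  where
  open ≡-Reasoning
  c t : ℕ
  c = count (15 + N) (holds (event N w P))
  t = #excluded P

-- Respectively satisfied by every fringed set that misses the sum 9 + j, the sum 19 + N + j or the difference 5 + m.
lowerSumEvent upperSumEvent differenceEvent : ℕ → ℕ → List Constraint
lowerSumEvent   N j = event N (5 + j) (nestedPairs 5 j)
upperSumEvent   N j = event N (5 + j) (nestedPairs (10 + j) (N ∸ j))
differenceEvent N m = event N (5 + m) (diffPairs 5 (10 + m) (m ⊓ (N ∸ m)))

count-nestedPairsEvent : ∀ N w a j → 5 ≤ w → 5 + w ≤ 10 + N → All (Interior N w) (positions (nestedPairs a j)) →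
                         count (15 + N) (holds (event N w (nestedPairs a j))) * 4 ^ ⌊ j /2⌋ ≡ 2 ^ N * 3 ^ ⌊ j /2⌋
count-nestedPairsEvent N w a j 5≤w window≤ inside =
  count-event N w (nestedPairs a j) ⌊ j /2⌋
              (event-wellFormed N w (nestedPairs a j) 5≤w window≤ inside (nestedPairs-unique a j))
              (sumPairs-#fixed a _ ⌊ j /2⌋) (sumPairs-#excluded a _ ⌊ j /2⌋)

count-lowerSumEvent : ∀ N j → j ≤ N →
                      count (15 + N) (holds (lowerSumEvent N j)) * 4 ^ ⌊ j /2⌋ ≡ 2 ^ N * 3 ^ ⌊ j /2⌋
count-lowerSumEvent N j j≤N =
  count-nestedPairsEvent N (5 + j) 5 j (m≤m+n 5 j) (+-monoʳ-≤ 10 j≤N) (All.map inj₁ (nestedPairs-positions 5 j))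

count-upperSumEvent : ∀ N j → j ≤ N →
                      count (15 + N) (holds (upperSumEvent N j)) * 4 ^ ⌊ N ∸ j /2⌋ ≡ 2 ^ N * 3 ^ ⌊ N ∸ j /2⌋
count-upperSumEvent N j j≤N =
  count-nestedPairsEvent N (5 + j) (10 + j) (N ∸ j) (m≤m+n 5 j) (+-monoʳ-≤ 10 j≤N)
    (All.map (inj₂ ∘ ∈[]-mono ≤-refl (≤-reflexive (cong (10 +_) (m+[n∸m]≡n j≤N))))
             (nestedPairs-positions (10 + j) (N ∸ j)))

count-differenceEvent : ∀ N m → m ≤ N →
  count (15 + N) (holds (differenceEvent N m)) * 4 ^ (m ⊓ (N ∸ m)) ≡ 2 ^ N * 3 ^ (m ⊓ (N ∸ m))
count-differenceEvent N m m≤N =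
  count-event N (5 + m) P t (event-wellFormed N (5 + m) P (m≤m+n 5 m) (+-monoʳ-≤ 10 m≤N) inside unique)
              (diffPairs-#fixed 5 (10 + m) t) (diffPairs-#excluded 5 (10 + m) t)
  where
  t : ℕ
  t = m ⊓ (N ∸ m)
  P : List Constraint
  P = diffPairs 5 (10 + m) t
  m+t≤N : m + t ≤ N
  m+t≤N = ≤-trans (+-monoʳ-≤ m (m⊓n≤n m (N ∸ m))) (≤-reflexive (m+[n∸m]≡n m≤N))
  inside : All (Interior N (5 + m)) (positions P)
  inside = All.map (Sum.map (∈[]-mono ≤-refl (+-monoʳ-≤ 5 (m⊓n≤m m (N ∸ m))))
                            (∈[]-mono ≤-refl (+-monoʳ-≤ 10 m+t≤N)))
                   (diffPairs-positions 5 (10 + m) t)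
  unique : Unique (positions P)
  unique = diffPairs-unique 5 (10 + m) t (≤-trans (+-monoʳ-≤ 5 (m⊓n≤m m (N ∸ m))) (m≤n+m (5 + m) 5))

missingSumOrDifference : ∀ N → Vec Bool (15 + N) → Bool
missingSumOrDifference N v =
  any≤ N (holds ∘ lowerSumEvent N) v ∨ any≤ N (holds ∘ upperSumEvent N) v ∨ any≤ N (holds ∘ differenceEvent N) v

count-lowerSumEvents : ∀ N → sum≤ N (λ j → count (15 + N) (holds (lowerSumEvent N j))) ≤ 8 * 2 ^ N
count-lowerSumEvents N = sum≤-geometric-⌊/2⌋ N (2 ^ N) _ (λ j j≤N → ≤-reflexive (count-lowerSumEvent N j j≤N))

count-upperSumEvents : ∀ N → sum≤ N (λ j → count (15 + N) (holds (upperSumEvent N j))) ≤ 8 * 2 ^ N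
count-upperSumEvents N = begin
  sum≤ N c             ≡⟨ sum≤-reverse N c ⟨
  sum≤ N (c ∘ (N ∸_))  ≤⟨ sum≤-geometric-⌊/2⌋ N (2 ^ N) (c ∘ (N ∸_)) bound ⟩
  8 * 2 ^ N            ∎
  where
  open ≤-Reasoning
  c : ℕ → ℕ
  c j = count (15 + N) (holds (upperSumEvent N j))
  bound : ∀ u → u ≤ N → c (N ∸ u) * 4 ^ ⌊ u /2⌋ ≤ 2 ^ N * 3 ^ ⌊ u /2⌋
  bound u u≤N = ≤-reflexive (subst (λ k → c (N ∸ u) * 4 ^ ⌊ k /2⌋ ≡ 2 ^ N * 3 ^ ⌊ k /2⌋) (m∸[m∸n]≡n u≤N)
                                   (count-upperSumEvent N (N ∸ u) (m∸n≤m N u)))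

count-differenceEvents : ∀ N → sum≤ N (λ m → count (15 + N) (holds (differenceEvent N m))) ≤ 8 * 2 ^ N
count-differenceEvents N = sum≤-geometric-⊓ N (2 ^ N) _ (λ m m≤N → ≤-reflexive (count-differenceEvent N m m≤N))

count-missingSumOrDifference : ∀ N → count (15 + N) (missingSumOrDifference N) ≤ 24 * 2 ^ N
count-missingSumOrDifference N = begin
  count n (missingSumOrDifference N)        ≤⟨ count-∨ n (lower-any) _ ⟩
  count n lower-any + count n (λ v → upper-any v ∨ difference-any v)
                                            ≤⟨ +-monoʳ-≤ (count n lower-any) (count-∨ n upper-any difference-any) ⟩
  count n lower-any + (count n upper-any + count n difference-any)
                                            ≤⟨ +-mono-≤ (≤-trans (count-any≤ n N _) (count-lowerSumEvents N))
                                                 (+-mono-≤ (≤-trans (count-any≤ n N _) (count-upperSumEvents N))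
                                                           (≤-trans (count-any≤ n N _) (count-differenceEvents N))) ⟩
  8 * 2 ^ N + (8 * 2 ^ N + 8 * 2 ^ N)       ≡⟨ three-eights (2 ^ N) ⟩
  24 * 2 ^ N                                ∎
  where
  open ≤-Reasoning
  n : ℕ
  n = 15 + N
  lower-any upper-any difference-any : Vec Bool n → Bool
  lower-any = any≤ N (holds ∘ lowerSumEvent N)
  upper-any = any≤ N (holds ∘ upperSumEvent N)
  difference-any = any≤ N (holds ∘ differenceEvent N)
  three-eights : ∀ a → 8 * a + (8 * a + 8 * a) ≡ 24 * a
  three-eights = solve-∀

IsSum : ∀ {n} → Vec Bool n → ℕ → Set
IsSum S s = Σ[ x ∈ ℕ ] Σ[ y ∈ ℕ ] bit S x ≡ true × bit S y ≡ true × x + y ≡ s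

IsDifference : ∀ {n} → Vec Bool n → ℕ → Set
IsDifference S d = Σ[ y ∈ ℕ ] bit S y ≡ true × bit S (y + d) ≡ true

module _ {n} (v : Vec Bool n) where

  fill-true : ∀ a l → holds (fill a l true) v ≡ true → ∀ e → e < l → bit v (a + e) ≡ true
  fill-true a (suc l) h zero    _         = trans (cong (bit v) (+-identityʳ a)) (∧-conicalˡ _ _ h)
  fill-true a (suc l) h (suc e) (s≤s e<l) =
    trans (cong (bit v) (+-suc a e)) (fill-true (suc a) l (∧-conicalʳ _ _ h) e e<l)

  fill-false : ∀ a l → holds (fill a l false) v ≡ false → Σ[ e ∈ ℕ ] e < l × bit v (a + e) ≡ true
  fill-false a (suc l) h with bit v a in eq
  ... | true  = 0 , z<s , trans (cong (bit v) (+-identityʳ a)) eq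
  ... | false with fill-false (suc a) l h
  ...   | e , e<l , b = suc e , s≤s e<l , trans (cong (bit v) (+-suc a e)) b

  both-set : ∀ i j → not (bit v i ∧ bit v j) ≡ false → bit v i ≡ true × bit v j ≡ true
  both-set i j h = ∧-conicalˡ _ _ (not-injective h) , ∧-conicalʳ _ _ (not-injective h)

  sumPairs-violated : ∀ a b t s → a + (b + t) ≡ suc s → holds (sumPairs a b t) v ≡ false → IsSum v s
  sumPairs-violated a b (suc t) s a+b+t≡ h
    with shifted ← trans (sym (trans (cong (a +_) (+-suc b t)) (+-suc a (b + t)))) a+b+t≡
       | ∧-false (not (bit v a ∧ bit v (b + t))) _ h
  ... | inj₁ pair = a , b + t , proj₁ (both-set a (b + t) pair) , proj₂ (both-set a (b + t) pair) ,
                    suc-injective shifted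
  ... | inj₂ rest = sumPairs-violated (suc a) b t s shifted rest

  nestedPairs-violated : ∀ a j s → a + (a + j) ≡ suc s → holds (nestedPairs a j) v ≡ false → IsSum v s
  nestedPairs-violated a j s eq =
    sumPairs-violated a (a + ⌈ j /2⌉) ⌊ j /2⌋ s (trans (cong (a +_) (nestedPairs-end a j)) eq)

  diffPairs-violated : ∀ a d t → holds (diffPairs a (a + d) t) v ≡ false → IsDifference v d
  diffPairs-violated a d (suc t) h with ∧-false (not (bit v a ∧ bit v (a + d))) _ h
  ... | inj₁ pair = a , both-set a (a + d) pair
  ... | inj₂ rest = diffPairs-violated (suc a) d t rest

data Cut (a : ℕ) : ℕ → Set where
  below : ∀ {s} → s < a → Cut a s
  above : ∀ k → Cut a (a + k)

cut : ∀ a s → Cut a s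
cut zero    s       = above s
cut (suc a) zero    = below z<s
cut (suc a) (suc s) with cut a s
... | below s<a = below (s≤s s<a)
... | above k   = above k

complement : ∀ e → e < 5 → Σ[ e′ ∈ ℕ ] e′ < 5 × e + e′ ≡ 4
complement e (s≤s e≤4) = 4 ∸ e , s≤s (m∸n≤m 4 e) , m+[n∸m]≡n e≤4

digits : ∀ k → k < 9 → Σ[ a ∈ ℕ ] Σ[ b ∈ ℕ ] a < 5 × b < 5 × a + b ≡ k
digits k k<9 with cut 5 k
... | below k<5 = 0 , k , z<s , k<5 , refl
... | above r   = 4 , suc r , ≤-refl , s≤s (s≤s (+-cancelˡ-≤ 5 r 3 (≤-pred k<9))) , refl

module Coverage (N : ℕ) (S : Vec Bool (15 + N))
                (fringe-holds : holds (fringe N) S ≡ true)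
                (nothing-missing : missingSumOrDifference N S ≡ false) where

  private
    fringe-halves : holds (fill 0 5 true) S ∧ holds (fill (10 + N) 5 true) S ≡ true
    fringe-halves = trans (sym (holds-++ (fill 0 5 true) (fill (10 + N) 5 true) S)) fringe-holds

  left : ∀ e → e < 5 → bit S e ≡ true
  left = fill-true S 0 5 (∧-conicalˡ (holds (fill 0 5 true) S) _ fringe-halves)

  right : ∀ e → e < 5 → bit S (10 + N + e) ≡ true
  right = fill-true S (10 + N) 5 (∧-conicalʳ (holds (fill 0 5 true) S) _ fringe-halves)

  interior-violated : ∀ w P → holds (event N w P) S ≡ false → holds (fill w 5 false ++ P) S ≡ false
  interior-violated w P h = trans (cong (_∧ holds (fill w 5 false ++ P) S) (sym fringe-holds))
                                  (trans (sym (holds-++ (fringe N) (fill w 5 false ++ P) S)) h)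

  event-violated : ∀ w P → holds (event N w P) S ≡ false →
                   (Σ[ e ∈ ℕ ] e < 5 × bit S (w + e) ≡ true) ⊎ holds P S ≡ false
  event-violated w P h
    with ∧-false (holds (fill w 5 false) S) (holds P S)
                 (trans (sym (holds-++ (fill w 5 false) P S)) (interior-violated w P h))
  ... | inj₁ window = inj₁ (fill-false S w 5 window)
  ... | inj₂ pairs  = inj₂ pairs

  no-lowerSumEvent : ∀ j → j ≤ N → holds (lowerSumEvent N j) S ≡ false
  no-lowerSumEvent j j≤N = any≤-false N (holds ∘ lowerSumEvent N) S j j≤N (∨-conicalˡ _ _ nothing-missing)

  no-upper-or-difference : any≤ N (holds ∘ upperSumEvent N) S ∨ any≤ N (holds ∘ differenceEvent N) S ≡ false
  no-upper-or-difference = ∨-conicalʳ (any≤ N (holds ∘ lowerSumEvent N) S) _ nothing-missing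

  no-upperSumEvent : ∀ j → j ≤ N → holds (upperSumEvent N j) S ≡ false
  no-upperSumEvent j j≤N = any≤-false N (holds ∘ upperSumEvent N) S j j≤N (∨-conicalˡ _ _ no-upper-or-difference)

  no-differenceEvent : ∀ m → m ≤ N → holds (differenceEvent N m) S ≡ false
  no-differenceEvent m m≤N = any≤-false N (holds ∘ differenceEvent N) S m m≤N (∨-conicalʳ _ _ no-upper-or-difference)

  window-sum-left : ∀ w → (Σ[ e ∈ ℕ ] e < 5 × bit S (w + e) ≡ true) → IsSum S (w + 4)
  window-sum-left w (e , e<5 , w+e∈S) with complement e e<5
  ... | e′ , e′<5 , e+e′≡4 = w + e , e′ , w+e∈S , left e′ e′<5 , trans (+-assoc w e e′) (cong (w +_) e+e′≡4)

  window-sum-right : ∀ w → (Σ[ e ∈ ℕ ] e < 5 × bit S (w + e) ≡ true) → IsSum S (w + (10 + N + 4))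
  window-sum-right w (e , e<5 , w+e∈S) with complement e e<5
  ... | e′ , e′<5 , e+e′≡4 = w + e , 10 + N + e′ , w+e∈S , right e′ e′<5 ,
                             trans (regroup w e (10 + N) e′) (cong (λ z → w + (10 + N + z)) e+e′≡4)
    where
    regroup : ∀ w e c e′ → w + e + (c + e′) ≡ w + (c + (e + e′))
    regroup = solve-∀

  lower-sum : ∀ j → j ≤ N → IsSum S (9 + j)
  lower-sum j j≤N with event-violated (5 + j) (nestedPairs 5 j) (no-lowerSumEvent j j≤N)
  ... | inj₁ window = subst (IsSum S) (+-comm (5 + j) 4) (window-sum-left (5 + j) window)
  ... | inj₂ pairs  = nestedPairs-violated S 5 j (9 + j) refl pairs

  upper-sum : ∀ j → j ≤ N → IsSum S (10 + N + (9 + j))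
  upper-sum j j≤N with event-violated (5 + j) (nestedPairs (10 + j) (N ∸ j)) (no-upperSumEvent j j≤N)
  ... | inj₁ window = subst (IsSum S) (regroup j N) (window-sum-right (5 + j) window)
    where
    regroup : ∀ j N → 5 + j + (10 + N + 4) ≡ 10 + N + (9 + j)
    regroup = solve-∀
  ... | inj₂ pairs  = nestedPairs-violated S (10 + j) (N ∸ j) _ pair-sum pairs
    where
    regroup : ∀ j N → 10 + j + (10 + N) ≡ suc (10 + N + (9 + j))
    regroup = solve-∀
    pair-sum : 10 + j + (10 + j + (N ∸ j)) ≡ suc (10 + N + (9 + j))
    pair-sum = trans (cong (λ z → 10 + j + (10 + z)) (m+[n∸m]≡n j≤N)) (regroup j N)

  low-sum : ∀ k → k < 9 → IsSum S k
  low-sum k k<9 with digits k k<9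
  ... | a , b , a<5 , b<5 , a+b≡k = a , b , left a a<5 , left b b<5 , a+b≡k

  middle-sum : ∀ k → k < 9 → IsSum S (10 + N + k)
  middle-sum k k<9 with digits k k<9
  ... | a , b , a<5 , b<5 , a+b≡k =
    a , 10 + N + b , left a a<5 , right b b<5 , trans (x∙yz≈y∙xz a (10 + N) b) (cong (10 + N +_) a+b≡k)

  high-sum : ∀ k → k < 9 → IsSum S (10 + N + (10 + N + k))
  high-sum k k<9 with digits k k<9
  ... | a , b , a<5 , b<5 , a+b≡k = 10 + N + a , 10 + N + b , right a a<5 , right b b<5 ,
                                    trans (regroup (10 + N) a b) (cong (λ z → 10 + N + (10 + N + z)) a+b≡k)
    where
    regroup : ∀ c a b → c + a + (c + b) ≡ c + (c + (a + b))
    regroup = solve-∀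

  all-sums : ∀ s → s ≤ (14 + N) + (14 + N) → IsSum S s
  all-sums s s≤ with cut (10 + N) s
  all-sums s s≤ | below s<10+N with cut 9 s
  ... | below s<9 = low-sum s s<9
  ... | above j   = lower-sum j (+-cancelˡ-≤ 10 j N s<10+N)
  all-sums _ s≤ | above s′ with cut 9 s′
  ... | below s′<9 = middle-sum s′ s′<9
  ... | above j with cut (suc N) j
  ...   | below j<1+N = upper-sum j (≤-pred j<1+N)
  ...   | above k     = high-sum k (s≤s (+-cancelˡ-≤ (10 + N) k 8 (+-cancelˡ-≤ (10 + N) _ _ s≤′)))
    where
    regroup : ∀ N → 14 + N + (14 + N) ≡ 10 + N + (10 + N + 8)
    regroup = solve-∀
    s≤′ : 10 + N + (10 + N + k) ≤ 10 + N + (10 + N + 8)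
    s≤′ = ≤-trans s≤ (≤-reflexive (regroup N))

  small-difference : ∀ d → d < 5 → IsDifference S d
  small-difference d d<5 = 0 , left 0 z<s , left d d<5

  middle-difference : ∀ m → m ≤ N → IsDifference S (5 + m)
  middle-difference m m≤N
    with event-violated (5 + m) (diffPairs 5 (10 + m) (m ⊓ (N ∸ m))) (no-differenceEvent m m≤N)
  ... | inj₁ (e , e<5 , b) = e , left e e<5 , subst (λ x → bit S x ≡ true) (+-comm (5 + m) e) b
  ... | inj₂ pairs         = diffPairs-violated S 5 (5 + m) (m ⊓ (N ∸ m)) pairs

  large-difference : ∀ k → k < 9 → IsDifference S (6 + N + k)
  large-difference k k<9 with digits k k<9
  ... | a , b , a<5 , b<5 , refl with complement a a<5
  ...   | a′ , a′<5 , a+a′≡4 = a′ , left a′ a′<5 , subst (λ x → bit S x ≡ true) (sym reach) (right b b<5)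
    where
    regroup : ∀ a a′ b N → a′ + (6 + N + (a + b)) ≡ a + a′ + (6 + N + b)
    regroup = solve-∀
    reach : a′ + (6 + N + (a + b)) ≡ 10 + N + b
    reach = trans (regroup a a′ b N) (cong (_+ (6 + N + b)) a+a′≡4)

  all-differences : ∀ d → d ≤ 14 + N → IsDifference S d
  all-differences d d≤ with cut 5 d
  ... | below d<5 = small-difference d d<5
  ... | above m with cut (suc N) m
  ...   | below m<1+N = middle-difference m (≤-pred m<1+N)
  ...   | above k     = large-difference k (s≤s (+-cancelˡ-≤ (6 + N) k 8 d≤′))
    where
    d≤′ : 6 + N + k ≤ 6 + N + 8
    d≤′ = ≤-trans d≤ (≤-reflexive (cong (6 +_) (+-comm 8 N)))

-- Cardinalities of the sumset and the shifted difference set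

missingOne⇒∣p∣≡n : ∀ {n} (p : Subset (suc n)) x → x ∉ p → (∀ y → y ≢ x → y ∈ p) → ∣ p ∣ ≡ n
missingOne⇒∣p∣≡n {n} p x x∉p others∈p = begin
  ∣ p ∣              ≡⟨ cong ∣_∣ (⊆-antisym p⊆∁⁅x⁆ ∁⁅x⁆⊆p) ⟩
  ∣ ∁ ⁅ x ⁆ ∣        ≡⟨ ∣∁p∣≡n∸∣p∣ ⁅ x ⁆ ⟩
  suc n ∸ ∣ ⁅ x ⁆ ∣  ≡⟨ cong (suc n ∸_) (∣⁅x⁆∣≡1 x) ⟩
  n                  ∎
  where
  open ≡-Reasoning
  p⊆∁⁅x⁆ : ∀ {y} → y ∈ p → y ∈ ∁ ⁅ x ⁆
  p⊆∁⁅x⁆ y∈p = x∉p⇒x∈∁p (x≢y⇒x∉⁅y⁆ λ { refl → x∉p y∈p })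
  ∁⁅x⁆⊆p : ∀ {y} → y ∈ ∁ ⁅ x ⁆ → y ∈ p
  ∁⁅x⁆⊆p {y} y∈∁ = others∈p y (x∉⁅y⁆⇒x≢y (x∈∁p⇒x∉p y∈∁))

module _ {n} {P : Fin n → Set} (P? : ∀ k → Dec (P k)) where

  ∈-tabulate⁺ : ∀ {k} → P k → k ∈ tabulate (λ k → ⌊ P? k ⌋)
  ∈-tabulate⁺ {k} Pk =
    lookup⇒[]= k _ (trans (lookup∘tabulate _ k) (trans (isYes≗does (P? k)) (dec-true (P? k) Pk)))

  ∉-tabulate⁺ : ∀ {k} → ¬ P k → k ∉ tabulate (λ k → ⌊ P? k ⌋)
  ∉-tabulate⁺ {k} ¬Pk k∈ with () ← trans (sym (trans (isYes≗does (P? k)) (dec-false (P? k) ¬Pk)))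
                                         (trans (sym (lookup∘tabulate _ k)) ([]=⇒lookup k∈))

bit⇒∈ : ∀ {n} (S : Subset n) x → bit S x ≡ true → Σ[ a ∈ Fin n ] toℕ a ≡ x × a ∈ S
bit⇒∈ (true ∷ S) zero    refl = Fin.zero , refl , here
bit⇒∈ (_ ∷ S)    (suc x) h with bit⇒∈ S x h
... | a , refl , a∈S = Fin.suc a , refl , there a∈S

IsSum⇒InSumset : ∀ {n} (S : Subset n) s → IsSum S s → InSumset S s
IsSum⇒InSumset S s (x , y , x∈S , y∈S , x+y≡s) with bit⇒∈ S x x∈S | bit⇒∈ S y y∈S
... | a , refl , a∈S | b , refl , b∈S = a , b , a∈S , b∈S , x+y≡s

module _ {m} (S : Subset (suc m)) where

  IsDifference⇒InDiffsetShifted-above : ∀ d → IsDifference S d → InDiffsetShifted S (suc m + d)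
  IsDifference⇒InDiffsetShifted-above d (y , y∈S , y+d∈S) with bit⇒∈ S y y∈S
  ... | b , refl , b∈S with bit⇒∈ S (y + d) y+d∈S
  ...   | a , a≡y+d , a∈S =
    a , b , a∈S , b∈S , trans (cong (_+ suc m) a≡y+d) (trans (+-assoc y d _) (cong (y +_) (+-comm d (suc m))))

  IsDifference⇒InDiffsetShifted-below : ∀ d k → k + d ≡ suc m → IsDifference S d → InDiffsetShifted S k
  IsDifference⇒InDiffsetShifted-below d k k+d≡ (y , y∈S , y+d∈S) with bit⇒∈ S y y∈S
  ... | a , refl , a∈S with bit⇒∈ S (y + d) y+d∈S
  ...   | b , b≡y+d , b∈S =
    a , b , a∈S , b∈S ,
    trans (cong (y +_) (trans (sym k+d≡) (+-comm k d))) (trans (sym (+-assoc y d k)) (cong (_+ k) (sym b≡y+d)))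

  ∣sumset∣≡ : (∀ s → s ≤ m + m → IsSum S s) → ∣ sumset S ∣ ≡ m + suc m
  ∣sumset∣≡ sums = missingOne⇒∣p∣≡n (sumset S) (fromℕ (m + suc m)) top∉ others∈
    where
    top∉ : fromℕ (m + suc m) ∉ sumset S
    top∉ = ∉-tabulate⁺ (λ k → inSumset? S (toℕ k)) λ (a , b , _ , _ , a+b≡top) →
      <⇒≢ (≤-trans (s≤s (+-mono-≤ (≤-pred (toℕ<n a)) (≤-pred (toℕ<n b)))) (≤-reflexive (sym (+-suc m m))))
          (trans a+b≡top (toℕ-fromℕ _))
    others∈ : ∀ k → k ≢ fromℕ (m + suc m) → k ∈ sumset S
    others∈ k k≢top = ∈-tabulate⁺ (λ k → inSumset? S (toℕ k)) (IsSum⇒InSumset S (toℕ k) (sums (toℕ k) k≤m+m))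
      where
      k<top : toℕ k < m + suc m
      k<top = ≤∧≢⇒< (≤-pred (toℕ<n k)) (λ k≡top → k≢top (toℕ-injective (trans k≡top (sym (toℕ-fromℕ _)))))
      k≤m+m : toℕ k ≤ m + m
      k≤m+m = ≤-pred (≤-trans k<top (≤-reflexive (+-suc m m)))

  ∣diffsetShifted∣≡ : (∀ d → d ≤ m → IsDifference S d) → ∣ diffsetShifted S ∣ ≡ m + suc m
  ∣diffsetShifted∣≡ differences = missingOne⇒∣p∣≡n (diffsetShifted S) Fin.zero zero∉ others∈
    where
    zero∉ : Fin.zero ∉ diffsetShifted S
    zero∉ = ∉-tabulate⁺ (λ k → inDiff? S (toℕ k)) λ (a , b , _ , _ , a+n≡b+0) →
      <⇒≢ (≤-trans (≤-trans (s≤s (≤-reflexive (+-identityʳ (toℕ b)))) (toℕ<n b)) (m≤n+m (suc m) (toℕ a)))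
          (sym a+n≡b+0)
    shifted : ∀ k → 0 < k → k < suc m + suc m → InDiffsetShifted S k
    shifted k 0<k k<2n with cut (suc m) k
    ... | above d = IsDifference⇒InDiffsetShifted-above d (differences d (≤-pred (+-cancelˡ-< (suc m) d (suc m) k<2n)))
    ... | below k<n with m≤n⇒∃[o]m+o≡n (<⇒≤ k<n)
    ...   | d , k+d≡n = IsDifference⇒InDiffsetShifted-below d k k+d≡n
                          (differences d (≤-pred (≤-trans (+-monoˡ-≤ d 0<k) (≤-reflexive k+d≡n))))
    others∈ : ∀ k → k ≢ Fin.zero → k ∈ diffsetShifted S
    others∈ Fin.zero    0≢0 = contradiction refl 0≢0
    others∈ (Fin.suc k) _   =
      ∈-tabulate⁺ (λ k → inDiff? S (toℕ k)) (shifted (suc (toℕ k)) z<s (toℕ<n (Fin.suc k)))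

  full⇒balanced : (∀ s → s ≤ m + m → IsSum S s) → (∀ d → d ≤ m → IsDifference S d) →
                  ∣ sumset S ∣ ≡ ∣ diffsetShifted S ∣
  full⇒balanced sums differences = trans (∣sumset∣≡ sums) (sym (∣diffsetShifted∣≡ differences))

balanced? : ∀ {n} → Subset n → Bool
balanced? S = does (∣ sumset S ∣ ≟ ∣ diffsetShifted S ∣)

length-filter-map : ∀ {A B : Set} {P : Pred B 0ℓ} (P? : Decidable P) (f : A → B) xs →
                    length (filter P? (map f xs)) ≡ length (filter (λ x → P? (f x)) xs)
length-filter-map P? f []       = refl
length-filter-map P? f (x ∷ xs) with does (P? (f x))
... | true  = cong suc (length-filter-map P? f xs)
... | false = length-filter-map P? f xs

opaque
  unfolding count

  length-filter-allSubsets : ∀ n {P : Pred (Subset n) 0ℓ} (P? : Decidable P) →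
                             length (filter P? (allSubsets n)) ≡ count n (λ S → does (P? S))
  length-filter-allSubsets zero    P? with does (P? [])
  ... | true  = refl
  ... | false = refl
  length-filter-allSubsets (suc n) P? = begin
    length (filter P? (with1 ++ with0))                   ≡⟨ cong length (filter-++ P? with1 with0) ⟩
    length (filter P? with1 ++ filter P? with0)           ≡⟨ length-++ (filter P? with1) ⟩
    length (filter P? with1) + length (filter P? with0)   ≡⟨ cong₂ _+_ (from-head true) (from-head false) ⟩
    count n (λ S → does (P? (true ∷ S))) + count n (λ S → does (P? (false ∷ S))) ∎
    where
    open ≡-Reasoning
    with1 with0 : List (Subset (suc n))
    with1 = map (true ∷_) (allSubsets n)
    with0 = map (false ∷_) (allSubsets n)
    from-head : ∀ x → length (filter P? (map (x ∷_) (allSubsets n))) ≡ count n (λ S → does (P? (x ∷ S)))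
    from-head x = trans (length-filter-map P? (x ∷_) (allSubsets n)) (length-filter-allSubsets n (λ S → P? (x ∷ S)))

countBalanced≡count : ∀ n → countBalanced n ≡ count n balanced?
countBalanced≡count n = length-filter-allSubsets n (λ S → ∣ sumset S ∣ ≟ ∣ diffsetShifted S ∣)

count-fringe : ∀ N → count (15 + N) (holds (fringe N)) ≡ 32 * 2 ^ N
count-fringe N = *-cancelʳ-≡ _ _ 1024 (begin
  c * 1024           ≡⟨ *-identityʳ (c * 1024) ⟨
  c * 1024 * 1       ≡⟨ count-holds (15 + N) (fringe N) (fringe-wellFormed N) ⟩
  2 ^ (15 + N) * 1   ≡⟨ *-identityʳ _ ⟩
  2 ^ (15 + N)       ≡⟨ ^-distribˡ-+-* 2 15 N ⟩
  32768 * 2 ^ N      ≡⟨ regroup (2 ^ N) ⟩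
  32 * 2 ^ N * 1024  ∎)
  where
  open ≡-Reasoning
  c : ℕ
  c = count (15 + N) (holds (fringe N))
  regroup : ∀ a → 32768 * a ≡ 32 * a * 1024
  regroup = solve-∀

balanced-if-nothing-missing : ∀ N (S : Subset (15 + N)) → holds (fringe N) S ≡ true →
                              missingSumOrDifference N S ≡ false → balanced? S ≡ true
balanced-if-nothing-missing N S fringe-holds nothing-missing =
  dec-true (∣ sumset S ∣ ≟ ∣ diffsetShifted S ∣) (full⇒balanced S all-sums all-differences)
  where open Coverage N S fringe-holds nothing-missing

-- Stated for arbitrary booleans because a `with` on missingSumOrDifference N S does not typecheck in reasonable time.
¬b∧f⇒m : ∀ b f m → (f ≡ true → m ≡ false → b ≡ true) → not b ∧ f ≡ true → m ≡ true
¬b∧f⇒m b     f     true  _      _  = refl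
¬b∧f⇒m true  f     false _      ()
¬b∧f⇒m false true  false f⇒¬m⇒b _  with () ← f⇒¬m⇒b refl refl
¬b∧f⇒m false false false _      ()

unbalanced⇒missing : ∀ N (S : Subset (15 + N)) → not (balanced? S) ∧ holds (fringe N) S ≡ true →
                     missingSumOrDifference N S ≡ true
unbalanced⇒missing N S =
  ¬b∧f⇒m (balanced? S) (holds (fringe N) S) (missingSumOrDifference N S) (balanced-if-nothing-missing N S)

count-balanced-15+ : ∀ N → 8 * 2 ^ N ≤ count (15 + N) balanced?
count-balanced-15+ N = +-cancelʳ-≤ (24 * 2 ^ N) _ _ (begin
  8 * 2 ^ N + 24 * 2 ^ N                                                       ≡⟨ regroup (2 ^ N) ⟩
  32 * 2 ^ N                                                                   ≡⟨ count-fringe N ⟨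
  count n F                                                                    ≡⟨ count-split n balanced? F ⟩
  count n (λ S → balanced? S ∧ F S) + count n (λ S → not (balanced? S) ∧ F S)
    ≤⟨ +-mono-≤ (count-mono n (λ S → ∧-conicalˡ (balanced? S) (F S)))
                (≤-trans (count-mono n (unbalanced⇒missing N)) (count-missingSumOrDifference N)) ⟩
  count n balanced? + 24 * 2 ^ N                                               ∎)
  where
  open ≤-Reasoning
  n : ℕ
  n = 15 + N
  F : Vec Bool n → Bool
  F = holds (fringe N)
  regroup : ∀ a → 8 * a + 24 * a ≡ 32 * a
  regroup = solve-∀

empty-balanced : ∀ n → balanced? (∅ {n}) ≡ true
empty-balanced n = dec-true (∣ sumset (∅ {n}) ∣ ≟ ∣ diffsetShifted (∅ {n}) ∣)
  (trans (∣empty∣ (sumset (∅ {n})) (λ (k , k∈) → ∉-tabulate⁺ (λ k → inSumset? ∅ (toℕ k)) no-witness k∈))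
         (sym (∣empty∣ (diffsetShifted (∅ {n})) (λ (k , k∈) → ∉-tabulate⁺ (λ k → inDiff? ∅ (toℕ k)) no-witness k∈))))
  where
  ∣empty∣ : ∀ {m} (p : Subset m) → Empty p → ∣ p ∣ ≡ 0
  ∣empty∣ {m} p p-empty = trans (cong ∣_∣ (Empty-unique p-empty)) (∣⊥∣≡0 m)
  no-witness : ∀ {R : Fin n → Fin n → Set} → ¬ (Σ[ a ∈ Fin n ] Σ[ b ∈ Fin n ] a ∈ ∅ × R a b)
  no-witness (_ , _ , a∈∅ , _) = ∉⊥ a∈∅

-- Takes the Cut as an argument because `with cut 15 n` does not typecheck in reasonable time.
count-balanced-lower-bound : ∀ n → Cut 15 n → 2 * 2 ^ n ≤ 100000 * count n balanced?
count-balanced-lower-bound n (below n<15) = begin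
  2 * 2 ^ n                   ≤⟨ *-monoʳ-≤ 2 (^-monoʳ-≤ 2 (≤-pred n<15)) ⟩
  2 * 2 ^ 14                  ≤⟨ m≤m+n 32768 67232 ⟩
  100000 * 1                  ≤⟨ *-monoʳ-≤ 100000 (count-pos n balanced? ∅ (empty-balanced n)) ⟩
  100000 * count n balanced?  ∎
  where open ≤-Reasoning
count-balanced-lower-bound _ (above N) = begin
  2 * 2 ^ (15 + N)                   ≡⟨ cong (2 *_) (^-distribˡ-+-* 2 15 N) ⟩
  2 * (32768 * 2 ^ N)                ≡⟨ *-assoc 2 32768 (2 ^ N) ⟨
  65536 * 2 ^ N                      ≤⟨ *-monoˡ-≤ (2 ^ N) (m≤m+n 65536 734464) ⟩
  800000 * 2 ^ N                     ≡⟨ *-assoc 100000 8 (2 ^ N) ⟩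
  100000 * (8 * 2 ^ N)               ≤⟨ *-monoʳ-≤ 100000 (count-balanced-15+ N) ⟩
  100000 * count (15 + N) balanced?  ∎
  where open ≤-Reasoning

theorem16 : ∀ n → 1 ≤ n → 2 * 2 ^ n ≤ 100000 * countBalanced n
-- The bound holds for n = 0 as well.
theorem16 n _ =
  subst (λ c → 2 * 2 ^ n ≤ 100000 * c) (sym (countBalanced≡count n)) (count-balanced-lower-bound n (cut 15 n))
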